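{- Let $n,r\ge 1$ and let $\pi_1\le\pi_2\le\dots\le\pi_r$ be non-crossing partitions of $[n]$ (refinement order). Then the superposition of the $r$ chord diagrams $\Psi(\pi_1),\dots,\Psi(\pi_r)$, defined below, is a chord diagram in $\mathcal{C}_n^{(r)}$. In particular, its $rn$ arches are pairwise non-crossing.
   Context: Non-crossing partitions of $[n]$ are set partitions with no $i<j<k<l$ such that $i,k$ lie in one block and $j,l$ lie in another block. The refinement order is: $\pi\le\nu$ if every block of $\pi$ is contained in a block of $\nu$. Chord diagrams $\mathcal{C}_n$: non-crossing perfect matchings of $2n$ points on a line labelled $1,1',2,2',\dots,n,n'$ from left to right. Every arch joins an unprimed point to a primed point. The bijection $\Psi$: for each block $\{b_1<\dots<b_p\}$ of $\pi$, take the pairs $(b_k,b_{k+1})$ for $k<p$ and the pair $(b_p,b_1)$ (the pair $(b_1,b_1)$ if $p=1$). For each pair $(i,j)$, draw an arch from point $i$ to point $(j-1)'$, where $0'=n'$. $\mathcal{C}_n^{(r)}$: consider $2rn$ points at positions $1,\dots,2rn$. They are grouped from left to right into $2n$ bundles of $r$ consecutive points, labelled $1,1',2,2',\dots,n,n'$. $\mathcal{C}_n^{(r)}$ is the set of non-crossing perfect matchings of these $2rn$ points such that every arch $\{i<j\}$ satisfies $i+j-1\equiv 0\pmod{2r}$. Superposition of $C_1,\dots,C_r\in\mathcal{C}_n$: for each $s\in\{1,\dots,r\}$ and each arch of $C_s$ joining unprimed $i$ to primed $j'$, join the $s$-th point from the left of bundle $i$ to the $s$-th point from the right of bundle $j'$.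 -}

module Defs where

open import Data.Nat using (ℕ; zero; suc; _+_; _*_; _∸_; _≤_; _<_)
open import Data.Nat.Divisibility using (_∣_)
open import Data.Fin using (Fin; toℕ) renaming (_<_ to _<ᶠ_; _≤_ to _≤ᶠ_)
open import Data.Fin.Properties using () renaming (_<?_ to _<ᶠ?_)
open import Data.Nat.Properties using () renaming (_≟_ to _≟ℕ_)
open import Data.List using (List; []; _∷_; length; lookup; filter; concatMap; allFin)
open import Data.List.Relation.Unary.Any using (Any)
open import Data.Product using (_×_; _,_; proj₁; proj₂; ∃)
open import Data.Sum using (_⊎_)
open import Relation.Nullary using (¬_)
open import Relation.Nullary.Decidable using (_×-dec_)
open import Relation.Binary.PropositionalEquality using (_≡_; _≢_)

-- The ground set [n] = {1,…,n} is represented by Fin n (element k of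
-- Fin n stands for k+1).  A set partition is given by a block-labelling
-- function: i and j lie in the same block iff they have equal labels.

Partition : ℕ → Set
Partition n = Fin n → ℕ

SameBlock : ∀ {n} → Partition n → Fin n → Fin n → Set
SameBlock π i j = π i ≡ π j

NonCrossing : ∀ {n} → Partition n → Set
NonCrossing {n} π = (i j k l : Fin n) → i <ᶠ j → j <ᶠ k → k <ᶠ l →
  SameBlock π i k → SameBlock π j l → SameBlock π i j

Refines : ∀ {n} → Partition n → Partition n → Set
Refines {n} π ν = (i j : Fin n) → SameBlock π i j → SameBlock ν i j

-- The bijection Ψ.
-- For i in a block {b₁<…<b_p}, the successor of i is the next larger
-- element of its block, or b₁ (the minimum) if i = b_p.

successor : ∀ {n} → Partition n → Fin n → Fin n
successor {n} π i with filter (λ j → (i <ᶠ? j) ×-dec (π i ≟ℕ π j)) (allFin n)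
... | j ∷ _ = j
... | [] with filter (λ j → π i ≟ℕ π j) (allFin n)
...   | j ∷ _ = j
...   | [] = i

-- In Ψ(π) the pair (i, j) (j = successor of i) gives an arch from the
-- unprimed point i to the primed point (j-1)', where 0' = n'.
-- With 1-based labels: j₁ = toℕ j + 1, so (j₁ - 1) = toℕ j, and it is
-- replaced by n when it is 0.  This returns that 1-based primed label.
psiTarget : ∀ {n} → Partition n → Fin n → ℕ
psiTarget {n} π i with toℕ (successor π i)
... | zero  = n
... | suc m = suc m

-- Points 1,…,2rn; bundles 1,1',2,2',…,n,n' of r consecutive points.
-- Bundle of unprimed i (1-based) occupies (2i-2)r+1 … (2i-1)r,
-- bundle of primed j' occupies (2j-1)r+1 … 2jr.

-- s-th point from the left of unprimed bundle i (s, i 1-based)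
leftPoint : ℕ → ℕ → ℕ → ℕ
leftPoint r i s = (2 * i ∸ 2) * r + s

-- s-th point from the right of primed bundle j' (s, j 1-based)
rightPoint : ℕ → ℕ → ℕ → ℕ
rightPoint r j s = 2 * j * r ∸ s + 1

Arch : Set
Arch = ℕ × ℕ

superposition : ∀ {n} (r : ℕ) → (Fin r → Partition n) → List Arch
superposition {n} r πs =
  concatMap (λ s → concatMap (λ i →
      (leftPoint r (suc (toℕ i)) (suc (toℕ s)) ,
       rightPoint r (psiTarget (πs s) i) (suc (toℕ s))) ∷ [])
    (allFin n))
  (allFin r)

-- An arch is an (unordered) pair, stored as an ordered pair of ℕ.

OnArch : ℕ → Arch → Set
OnArch p (a , b) = p ≡ a ⊎ p ≡ b

Disjoint : Arch → Arch → Set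
Disjoint (a , b) (c , d) = a ≢ c × a ≢ d × b ≢ c × b ≢ d

Between : ℕ → Arch → Set
Between p (a , b) = (a < p × p < b) ⊎ (b < p × p < a)

Crossing : Arch → Arch → Set
Crossing x (c , d) =
  (Between c x × ¬ Between d x × ¬ OnArch d x)
  ⊎ (Between d x × ¬ Between c x × ¬ OnArch c x)

IsPerfectMatching : ℕ → List Arch → Set
IsPerfectMatching m A =
  ((k : Fin (length A)) → let (a , b) = lookup A k in
      1 ≤ a × a ≤ m × 1 ≤ b × b ≤ m × a ≢ b)
  × ((k l : Fin (length A)) → k ≢ l → Disjoint (lookup A k) (lookup A l))
  × ((p : ℕ) → 1 ≤ p → p ≤ m → Any (OnArch p) A)

IsNonCrossing : List Arch → Set
IsNonCrossing A = (k l : Fin (length A)) → ¬ Crossing (lookup A k) (lookup A l)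

ArchCondition : ℕ → List Arch → Set
ArchCondition r A = (k : Fin (length A)) → let (a , b) = lookup A k in
  (2 * r) ∣ (a + b ∸ 1)

InC : ℕ → ℕ → List Arch → Set
InC n r A = IsPerfectMatching (2 * r * n) A × IsNonCrossing A × ArchCondition r A

{-# OPTIONS --safe #-}
-- Read the 2rn points around a circle, so that the side of an arch on which a point lies is a
-- matter of cyclic betweenness. With 0-based indices, the arch of layer s at i joins the s-th
-- point of bundle i to the s-th point from the right of bundle (j − 1)′, where j is the successor
-- of i in its block of π_s. Hence, for the arch of layer s′ from k, where m is the successor of k
-- in its block of π_s′, its left end lies inside the arch of (s, i) iff
--   k ∈ (i, j) cyclically, or k = i and s < s′,
-- and its right end iff
--   m ∈ (i, j) cyclically, or m = j and s < s′,
-- since inside a bundle the layers are nested. The two conditions agree. If s′ ≤ s, then k and m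
-- share a block of π_s: the block of i has no element in (i, j), and any other block lies on one
-- side of i and j, as the blocks of a non-crossing partition do not interleave. If s < s′, then i
-- and j share a block of π_s′; either k lies in another block of π_s′, or m follows k in the block
-- of i and j, so that neither i nor j lies strictly between k and m, and then k ∈ [i, j) iff
-- m ∈ (i, j]. Arches with both ends on the same side do not cross.
-- The left ends are distinct by construction, the right ends since the block successor is a
-- permutation, and the parity of bundles shows that together they cover all 2rn points.
module Submission where

open import Defs
open import Data.Empty using (⊥)
open import Data.Fin using (Fin; toℕ; fromℕ<; punchOut) renaming (_<_ to _<ᶠ_; _≤_ to _≤ᶠ_)
import Data.Fin as Fin
open import Data.Fin.Properties using (toℕ<n; toℕ-injective; toℕ-fromℕ<; any?; injective⇒≤; punchOut-injective)
  renaming (_<?_ to _<ᶠ?_; _≟_ to _≟ᶠ_)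
open import Data.List
  using (List; []; _∷_; [_]; _++_; length; lookup; map; filter; concatMap; cartesianProduct; cartesianProductWith; allFin)
open import Data.List.Properties
  using (length-++; length-map; length-tabulate; map-++; map-∘; concatMap-map; concatMap-pure)
open import Data.List.Membership.Propositional using (_∈_)
open import Data.List.Membership.Propositional.Properties
  using (∈-allFin; ∈-lookup; ∈-map⁺; ∈-map⁻; ∈-cartesianProduct⁺; ∈-filter⁺; ∈-filter⁻)
open import Data.List.Relation.Unary.Any using (here; there)
import Data.List.Relation.Unary.Any as Any
import Data.List.Relation.Unary.All as All
open import Data.List.Relation.Unary.AllPairs using (AllPairs; _∷_)
import Data.List.Relation.Unary.AllPairs as AllPairs
import Data.List.Relation.Unary.AllPairs.Properties as AllPairs
open import Data.List.Relation.Unary.Unique.Propositional.Properties using (allFin⁺)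
  renaming (cartesianProduct⁺ to unique-cartesianProduct⁺)
open import Data.Nat
  using (ℕ; zero; suc; pred; NonZero; >-nonZero; _+_; _*_; _∸_; _≤_; _<_; z≤n; s≤s; s≤s⁻¹; s<s; s<s⁻¹; z<s)
open import Data.Nat.Divisibility using (_∣_; divides)
open import Data.Nat.DivMod using (_/_; _%_; m≡m%n+[m/n]*n; m%n<n; m<n*o⇒m/o<n)
open import Data.Nat.Properties renaming (_≟_ to _≟ℕ_)
open import Data.Nat.Tactic.RingSolver using (solve-∀)
open import Data.Product using (_×_; _,_; proj₁; proj₂; ∃; ∃₂; uncurry)
open import Data.Product.Function.NonDependent.Propositional using (_×-⇔_)
open import Data.Sum using (_⊎_; inj₁; inj₂; [_,_]′; map₂)
open import Data.Sum.Function.Propositional using (_⊎-⇔_)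
open import Function using (id; _∘_; _$_)
open import Function.Bundles using (_⇔_; mk⇔; Equivalence)
open import Function.Definitions using (Injective)
open import Function.Properties.Equivalence using (⇔-setoid)
import Function.Properties.Equivalence as ⇔
open import Level using (0ℓ)
open import Relation.Binary using (Symmetric; tri<; tri≈; tri>)
open import Relation.Binary.PropositionalEquality
  using (_≡_; _≢_; refl; sym; trans; cong; cong₂; subst; subst₂; ≢-sym; module ≡-Reasoning)
import Relation.Binary.Reasoning.Setoid as SetoidReasoning
open import Relation.Nullary using (¬_; contradiction; yes; no)
open import Relation.Nullary.Decidable using (_×-dec_)
open import Relation.Unary using (Pred; Decidable)

open Equivalence using (to; from)

module ⇔-Reasoning = SetoidReasoning (⇔-setoid 0ℓ)

⊎-dropʳ : ∀ {A B : Set} → ¬ B → (A ⊎ B) ⇔ A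
⊎-dropʳ ¬b = mk⇔ [ id , (λ b → contradiction b ¬b) ]′ inj₁

⊎-×-absorbʳ : ∀ {A B C : Set} → C → (A ⊎ B × C) ⇔ (A ⊎ B)
⊎-×-absorbʳ c = mk⇔ (map₂ proj₁) (map₂ (_, c))

-- k lies on the open arc from i up to j around the circle: for j ≤ i the arc wraps around,
-- and for j ≡ i it is everything except i.
CyclicBetween : ℕ → ℕ → ℕ → Set
CyclicBetween i k j = (i < k × k < j) ⊎ (j ≤ i × (i < k ⊎ k < j))

cyclicBetween-cong : ∀ {i k j i′ k′ j′} →
                     i < k ⇔ i′ < k′ → k < j ⇔ k′ < j′ → j ≤ i ⇔ j′ ≤ i′ →
                     CyclicBetween i k j ⇔ CyclicBetween i′ k′ j′
cyclicBetween-cong i<k k<j j≤i = (i<k ×-⇔ k<j) ⊎-⇔ (j≤i ×-⇔ (i<k ⊎-⇔ k<j))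

cyclicBetween-connex : ∀ {a b} c → a ≢ b → CyclicBetween a b c ⊎ CyclicBetween b a c
cyclicBetween-connex {a} {b} c a≢b with <-cmp a b
... | tri≈ _ a≡b _ = contradiction a≡b a≢b
... | tri< a<b _ _ with <-≤-connex b c | ≤-<-connex c a
...   | inj₁ b<c | _        = inj₁ (inj₁ (a<b , b<c))
...   | inj₂ c≤b | inj₁ c≤a = inj₁ (inj₂ (c≤a , inj₁ a<b))
...   | inj₂ c≤b | inj₂ a<c = inj₂ (inj₂ (c≤b , inj₂ a<c))
cyclicBetween-connex {a} {b} c a≢b | tri> _ _ b<a with <-≤-connex a c | ≤-<-connex c b
...   | inj₁ a<c | _        = inj₂ (inj₁ (b<a , a<c))
...   | inj₂ c≤a | inj₁ c≤b = inj₂ (inj₂ (c≤b , inj₁ b<a))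
...   | inj₂ c≤a | inj₂ b<c = inj₁ (inj₂ (c≤a , inj₂ b<c))

¬cyclicBetween-self : ∀ {k x} → ¬ CyclicBetween k x k → x ≡ k
¬cyclicBetween-self {k} {x} ¬k<x<k with <-cmp x k
... | tri< x<k _ _ = contradiction (inj₂ (≤-refl , inj₂ x<k)) ¬k<x<k
... | tri≈ _ x≡k _ = x≡k
... | tri> _ _ k<x = contradiction (inj₂ (≤-refl , inj₁ k<x)) ¬k<x<k

¬cyclicBetween-up : ∀ {k x m} → k < m → ¬ CyclicBetween k x m → x ≤ k ⊎ m ≤ x
¬cyclicBetween-up {k} {x} {m} k<m ¬k<x<m with ≤-<-connex x k | ≤-<-connex m x
... | inj₁ x≤k | _        = inj₁ x≤k
... | inj₂ _   | inj₁ m≤x = inj₂ m≤x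
... | inj₂ k<x | inj₂ x<m = contradiction (inj₁ (k<x , x<m)) ¬k<x<m

¬cyclicBetween-down : ∀ {k x m} → m < k → ¬ CyclicBetween k x m → m ≤ x × x ≤ k
¬cyclicBetween-down {k} {x} {m} m<k ¬k<x<m with ≤-<-connex m x | ≤-<-connex x k
... | inj₁ m≤x | inj₁ x≤k = m≤x , x≤k
... | inj₂ x<m | _        = contradiction (inj₂ (<⇒≤ m<k , inj₂ x<m)) ¬k<x<m
... | _        | inj₂ k<x = contradiction (inj₂ (<⇒≤ m<k , inj₁ k<x)) ¬k<x<m

private
  ≤⇒<⊎≡ : ∀ {A : Set} {a b} → (a < b → A) → a ≤ b → A ⊎ a ≡ b
  ≤⇒<⊎≡ f = [ inj₁ ∘ f , inj₂ ]′ ∘ m≤n⇒m<n∨m≡n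

  shift-up : ∀ {i j k m} → k < m → i ≤ k ⊎ m ≤ i → j ≤ k ⊎ m ≤ j →
             (CyclicBetween i k j ⊎ i ≡ k) ⇔ (CyclicBetween i m j ⊎ m ≡ j)
  shift-up {i} {j} {k} {m} k<m i-out j-out = mk⇔ (forth i-out j-out) (back i-out)
    where
    forth : i ≤ k ⊎ m ≤ i → j ≤ k ⊎ m ≤ j → CyclicBetween i k j ⊎ i ≡ k → CyclicBetween i m j ⊎ m ≡ j
    forth _          (inj₁ j≤k) (inj₂ refl)                    = inj₁ (inj₂ (j≤k , inj₁ k<m))
    forth _          (inj₂ m≤j) (inj₂ refl)                    = ≤⇒<⊎≡ (λ m<j → inj₁ (k<m , m<j)) m≤j
    forth _          (inj₁ j≤k) (inj₁ (inj₁ (_ , k<j)))        = contradiction j≤k (<⇒≱ k<j)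
    forth _          (inj₂ m≤j) (inj₁ (inj₁ (i<k , _)))        = ≤⇒<⊎≡ (λ m<j → inj₁ (<-trans i<k k<m , m<j)) m≤j
    forth _          _          (inj₁ (inj₂ (j≤i , inj₁ i<k))) = inj₁ (inj₂ (j≤i , inj₁ (<-trans i<k k<m)))
    forth (inj₁ i≤k) _          (inj₁ (inj₂ (j≤i , inj₂ k<j))) = contradiction (≤-trans j≤i i≤k) (<⇒≱ k<j)
    forth (inj₂ _)   (inj₁ j≤k) (inj₁ (inj₂ (_ , inj₂ k<j)))   = contradiction j≤k (<⇒≱ k<j)
    forth (inj₂ _)   (inj₂ m≤j) (inj₁ (inj₂ (j≤i , inj₂ _)))   = ≤⇒<⊎≡ (λ m<j → inj₂ (j≤i , inj₂ m<j)) m≤j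
    back : i ≤ k ⊎ m ≤ i → CyclicBetween i m j ⊎ m ≡ j → CyclicBetween i k j ⊎ i ≡ k
    back (inj₁ i≤k) (inj₂ refl)                    = ≤⇒<⊎≡ (λ i<k → inj₁ (i<k , k<m)) i≤k
    back (inj₂ m≤i) (inj₂ refl)                    = inj₁ (inj₂ (m≤i , inj₂ k<m))
    back (inj₁ i≤k) (inj₁ (inj₁ (_ , m<j)))        = ≤⇒<⊎≡ (λ i<k → inj₁ (i<k , <-trans k<m m<j)) i≤k
    back (inj₁ i≤k) (inj₁ (inj₂ (j≤i , inj₁ _)))   = ≤⇒<⊎≡ (λ i<k → inj₂ (j≤i , inj₁ i<k)) i≤k
    back (inj₂ m≤i) (inj₁ (inj₁ (i<m , _)))        = contradiction m≤i (<⇒≱ i<m)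
    back (inj₂ m≤i) (inj₁ (inj₂ (_ , inj₁ i<m)))   = contradiction m≤i (<⇒≱ i<m)
    back _          (inj₁ (inj₂ (j≤i , inj₂ m<j))) = inj₁ (inj₂ (j≤i , inj₂ (<-trans k<m m<j)))

  shift-down : ∀ {i j k m} → m < k → m ≤ i × i ≤ k → m ≤ j × j ≤ k →
               (CyclicBetween i k j ⊎ i ≡ k) ⇔ (CyclicBetween i m j ⊎ m ≡ j)
  shift-down {i} {j} {k} {m} m<k (m≤i , i≤k) (m≤j , j≤k) = mk⇔ forth back
    where
    forth : CyclicBetween i k j ⊎ i ≡ k → CyclicBetween i m j ⊎ m ≡ j
    forth (inj₂ refl)                    = ≤⇒<⊎≡ (λ m<j → inj₂ (j≤k , inj₂ m<j)) m≤j
    forth (inj₁ (inj₁ (_ , k<j)))        = contradiction j≤k (<⇒≱ k<j)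
    forth (inj₁ (inj₂ (j≤i , inj₁ _)))   = ≤⇒<⊎≡ (λ m<j → inj₂ (j≤i , inj₂ m<j)) m≤j
    forth (inj₁ (inj₂ (_ , inj₂ k<j)))   = contradiction j≤k (<⇒≱ k<j)
    back : CyclicBetween i m j ⊎ m ≡ j → CyclicBetween i k j ⊎ i ≡ k
    back (inj₂ refl)                  = ≤⇒<⊎≡ (λ i<k → inj₂ (m≤i , inj₁ i<k)) i≤k
    back (inj₁ (inj₁ (i<m , _)))      = contradiction m≤i (<⇒≱ i<m)
    back (inj₁ (inj₂ (_ , inj₁ i<m))) = contradiction m≤i (<⇒≱ i<m)
    back (inj₁ (inj₂ (j≤i , inj₂ _))) = ≤⇒<⊎≡ (λ i<k → inj₂ (j≤i , inj₁ i<k)) i≤k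

-- The two sides say k ∈ [i, j) and m ∈ (i, j].
cyclicBetween-shift : ∀ {i j k m} → ¬ CyclicBetween k i m → ¬ CyclicBetween k j m →
                      (CyclicBetween i k j ⊎ i ≡ k) ⇔ (CyclicBetween i m j ⊎ m ≡ j)
cyclicBetween-shift {i} {j} {k} {m} i-out j-out with <-cmp k m
... | tri< k<m _ _ = shift-up k<m (¬cyclicBetween-up k<m i-out) (¬cyclicBetween-up k<m j-out)
... | tri> _ _ m<k = shift-down m<k (¬cyclicBetween-down m<k i-out) (¬cyclicBetween-down m<k j-out)
... | tri≈ _ refl _ with ¬cyclicBetween-self i-out | ¬cyclicBetween-self j-out
...   | refl | refl = mk⇔ (λ _ → inj₂ refl) (λ _ → inj₂ refl)

private
  sameSide⇒¬Crossingˡ : ∀ {a b c d} → a ≢ b → CyclicBetween a c b ⇔ CyclicBetween a d b →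
             Between c (a , b) → ¬ Between d (a , b) → ¬ OnArch d (a , b) → ⊥
  sameSide⇒¬Crossingˡ {a} {b} {c} {d} a≢b c⇔d c-in d-out d∉ with <-cmp a b | c-in
  ... | tri≈ _ a≡b _ | _                 = a≢b a≡b
  ... | tri< a<b _ _ | inj₂ (b<c , c<a)  = <-asym a<b (<-trans b<c c<a)
  ... | tri> _ _ b<a | inj₁ (a<c , c<b)  = <-asym b<a (<-trans a<c c<b)
  ... | tri< a<b _ _ | inj₁ a<c<b with to c⇔d (inj₁ a<c<b)
  ...   | inj₁ a<d<b       = d-out (inj₁ a<d<b)
  ...   | inj₂ (b≤a , _)   = <⇒≱ a<b b≤a
  sameSide⇒¬Crossingˡ {a} {b} {c} {d} a≢b c⇔d c-in d-out d∉ | tri> _ _ b<a | inj₂ (b<c , c<a) =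
    c-outside (from c⇔d d-outside)
    where
    c-outside : ¬ CyclicBetween a c b
    c-outside (inj₁ (a<c , _))      = <-asym a<c c<a
    c-outside (inj₂ (_ , inj₁ a<c)) = <-asym a<c c<a
    c-outside (inj₂ (_ , inj₂ c<b)) = <-asym c<b b<c
    d-outside : CyclicBetween a d b
    d-outside with <-cmp d b | <-cmp d a
    ... | tri< d<b _ _ | _             = inj₂ (<⇒≤ b<a , inj₂ d<b)
    ... | tri≈ _ d≡b _ | _             = contradiction (inj₂ d≡b) d∉
    ... | tri> _ _ _   | tri≈ _ d≡a _  = contradiction (inj₁ d≡a) d∉
    ... | tri> _ _ _   | tri> _ _ a<d  = inj₂ (<⇒≤ b<a , inj₁ a<d)
    ... | tri> _ _ b<d | tri< d<a _ _  = contradiction (inj₂ (b<d , d<a)) d-out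

sameSide⇒¬Crossing : ∀ {a b c d} → a ≢ b → CyclicBetween a c b ⇔ CyclicBetween a d b →
                     ¬ Crossing (a , b) (c , d)
sameSide⇒¬Crossing a≢b c⇔d (inj₁ (c-in , d-out , d∉)) = sameSide⇒¬Crossingˡ a≢b c⇔d c-in d-out d∉
sameSide⇒¬Crossing a≢b c⇔d (inj₂ (d-in , c-out , c∉)) = sameSide⇒¬Crossingˡ a≢b (⇔.sym c⇔d) d-in c-out c∉


module _ {n} {P : Pred (Fin n) 0ℓ} (P? : Decidable P) where

  filter-head-least : ∀ {xs j ys} → AllPairs _<ᶠ_ xs → filter P? xs ≡ j ∷ ys →
                      P j × (∀ {x} → x ∈ xs → P x → j ≤ᶠ x)
  filter-head-least {xs} sorted eq with j<ys ∷ _ ← subst (AllPairs _<ᶠ_) eq (AllPairs.filter⁺ P? sorted) =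
    proj₂ (∈-filter⁻ P? {xs = xs} (subst (_ ∈_) (sym eq) (here refl))) , least
    where
    least : ∀ {x} → x ∈ xs → P x → _ ≤ᶠ x
    least x∈xs Px with subst (_ ∈_) eq (∈-filter⁺ P? x∈xs Px)
    ... | here refl  = ≤-refl
    ... | there x∈ys = <⇒≤ (All.lookup j<ys x∈ys)

  filter-[] : ∀ {xs x} → filter P? xs ≡ [] → x ∈ xs → ¬ P x
  filter-[] eq x∈xs Px with () ← subst (_ ∈_) eq (∈-filter⁺ P? x∈xs Px)

allFin-sorted : ∀ n → AllPairs _<ᶠ_ (allFin n)
allFin-sorted n = AllPairs.tabulate⁺-< (λ i<j → i<j)

IsSuccessor : ∀ {n} → Partition n → Fin n → Fin n → Set
IsSuccessor π i j = SameBlock π j i × (∀ x → SameBlock π x i → ¬ CyclicBetween (toℕ i) (toℕ x) (toℕ j))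

successor-isSuccessor : ∀ {n} (π : Partition n) i → IsSuccessor π i (successor π i)
successor-isSuccessor {n} π i with filter (λ j → (i <ᶠ? j) ×-dec (π i ≟ℕ π j)) (allFin n) in later
... | j ∷ _
  with (i<j , πi≡πj) , least ← filter-head-least (λ j → (i <ᶠ? j) ×-dec (π i ≟ℕ π j)) (allFin-sorted n) later
  = sym πi≡πj , gap
  where
  gap : ∀ x → π x ≡ π i → ¬ CyclicBetween (toℕ i) (toℕ x) (toℕ j)
  gap x πx≡πi (inj₁ (i<x , x<j)) = <⇒≱ x<j (least (∈-allFin x) (i<x , sym πx≡πi))
  gap x _     (inj₂ (j≤i , _))   = <⇒≱ i<j j≤i
... | [] with filter (λ j → π i ≟ℕ π j) (allFin n) in block
...   | j ∷ _
  with πi≡πj , least ← filter-head-least (λ j → π i ≟ℕ π j) (allFin-sorted n) block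
  = sym πi≡πj , gap
  where
  gap : ∀ x → π x ≡ π i → ¬ CyclicBetween (toℕ i) (toℕ x) (toℕ j)
  gap x πx≡πi (inj₁ (_ , x<j))        = <⇒≱ x<j (least (∈-allFin x) (sym πx≡πi))
  gap x πx≡πi (inj₂ (_ , inj₁ i<x))   =
    filter-[] (λ j → (i <ᶠ? j) ×-dec (π i ≟ℕ π j)) later (∈-allFin x) (i<x , sym πx≡πi)
  gap x πx≡πi (inj₂ (_ , inj₂ x<j))   = <⇒≱ x<j (least (∈-allFin x) (sym πx≡πi))
...   | [] = contradiction refl (filter-[] (λ j → π i ≟ℕ π j) block (∈-allFin i))

isSuccessor-injective : ∀ {n} {π : Partition n} {i i′ j} → IsSuccessor π i j → IsSuccessor π i′ j → i ≡ i′
isSuccessor-injective {i = i} {i′} {j} (j~i , gap) (j~i′ , gap′) with i ≟ᶠ i′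
... | yes i≡i′ = i≡i′
... | no i≢i′ with cyclicBetween-connex (toℕ j) (λ eq → i≢i′ (toℕ-injective eq))
...   | inj₁ i′-between = contradiction i′-between (gap i′ (trans (sym j~i′) j~i))
...   | inj₂ i-between  = contradiction i-between (gap′ i (trans (sym j~i) j~i′))

successor-injective : ∀ {n} (π : Partition n) → Injective _≡_ _≡_ (successor π)
successor-injective π {i} {i′} eq = isSuccessor-injective (successor-isSuccessor π i)
  (subst (IsSuccessor π i′) (sym eq) (successor-isSuccessor π i′))

injective⇒surjective : ∀ {n} {f : Fin n → Fin n} → Injective _≡_ _≡_ f → ∀ j → ∃ λ i → f i ≡ j
injective⇒surjective {suc n} {f} f-injective j with any? (λ i → f i ≟ᶠ j)
... | yes hit = hit
... | no miss = contradiction (injective⇒≤ punchOut∘f-injective) 1+n≰n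
  where
  j≢f : ∀ i → j ≢ f i
  j≢f i j≡fi = miss (i , sym j≡fi)
  punchOut∘f-injective : Injective _≡_ _≡_ (λ i → punchOut (j≢f i))
  punchOut∘f-injective eq = f-injective (punchOut-injective (j≢f _) (j≢f _) eq)

module _ {n} {π : Partition n} (nc : NonCrossing π) where

  -- Blocks of a non-crossing partition do not interleave.
  cyclicBetween-otherBlock : ∀ {i j k k′} → SameBlock π i j → SameBlock π k k′ → ¬ SameBlock π k i →
                             CyclicBetween (toℕ i) (toℕ k) (toℕ j) → CyclicBetween (toℕ i) (toℕ k′) (toℕ j)
  cyclicBetween-otherBlock {i} {j} {k} {k′} i~j k~k′ k≁i = go
    where
    k′≢i : toℕ k′ ≢ toℕ i
    k′≢i eq = k≁i (trans k~k′ (cong π (toℕ-injective eq)))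
    k′≢j : toℕ k′ ≢ toℕ j
    k′≢j eq = k≁i (trans k~k′ (trans (cong π (toℕ-injective eq)) (sym i~j)))
    go : CyclicBetween (toℕ i) (toℕ k) (toℕ j) → CyclicBetween (toℕ i) (toℕ k′) (toℕ j)
    go (inj₁ (i<k , k<j)) with <-cmp (toℕ k′) (toℕ i) | <-cmp (toℕ k′) (toℕ j)
    ... | tri≈ _ k′≡i _ | _             = contradiction k′≡i k′≢i
    ... | _             | tri≈ _ k′≡j _ = contradiction k′≡j k′≢j
    ... | tri< k′<i _ _ | _             = contradiction (trans k~k′ (nc k′ i k j k′<i i<k k<j (sym k~k′) i~j)) k≁i
    ... | tri> _ _ i<k′ | tri< k′<j _ _ = inj₁ (i<k′ , k′<j)
    ... | tri> _ _ _    | tri> _ _ j<k′ = contradiction (sym (nc i k j k′ i<k k<j j<k′ i~j k~k′)) k≁i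
    go (inj₂ (j≤i , k-outside)) with <-cmp (toℕ k′) (toℕ i) | <-cmp (toℕ k′) (toℕ j)
    ... | tri≈ _ k′≡i _ | _             = contradiction k′≡i k′≢i
    ... | _             | tri≈ _ k′≡j _ = contradiction k′≡j k′≢j
    ... | tri> _ _ i<k′ | _             = inj₂ (j≤i , inj₁ i<k′)
    ... | tri< _ _ _    | tri< k′<j _ _ = inj₂ (j≤i , inj₂ k′<j)
    ... | tri< k′<i _ _ | tri> _ _ j<k′ with k-outside
    ...   | inj₁ i<k =
      contradiction (trans k~k′ (trans (sym (nc j k′ i k j<k′ k′<i i<k (sym i~j) (sym k~k′))) (sym i~j))) k≁i
    ...   | inj₂ k<j = contradiction (trans (nc k j k′ i k<j j<k′ k′<i k~k′ (sym i~j)) (sym i~j)) k≁i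

  successor-sameBlock-⇔ : ∀ {i j k m} → IsSuccessor π i j → SameBlock π m k →
                          CyclicBetween (toℕ i) (toℕ k) (toℕ j) ⇔ CyclicBetween (toℕ i) (toℕ m) (toℕ j)
  successor-sameBlock-⇔ {i} {j} {k} {m} (j~i , gap) m~k with π k ≟ℕ π i
  ... | yes k~i = mk⇔ (λ k-between → contradiction k-between (gap k k~i))
                      (λ m-between → contradiction m-between (gap m (trans m~k k~i)))
  ... | no k≁i = mk⇔ (cyclicBetween-otherBlock (sym j~i) (sym m~k) k≁i)
                     (cyclicBetween-otherBlock (sym j~i) m~k (λ m~i → k≁i (trans (sym m~k) m~i)))

refinement-successor-⇔ : ∀ {n} {π π′ : Partition n} → NonCrossing π′ → Refines π π′ →
                         ∀ {i j k m} → IsSuccessor π i j → IsSuccessor π′ k m →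
                         (CyclicBetween (toℕ i) (toℕ k) (toℕ j) ⊎ toℕ i ≡ toℕ k) ⇔
                         (CyclicBetween (toℕ i) (toℕ m) (toℕ j) ⊎ toℕ m ≡ toℕ j)
refinement-successor-⇔ {π′ = π′} nc′ π≤π′ {i} {j} {k} {m} (j~i , _) (m~′k , gap′) with π′ k ≟ℕ π′ i
... | yes k~′i = cyclicBetween-shift (gap′ i (sym k~′i)) (gap′ j (trans (π≤π′ j i j~i) (sym k~′i)))
... | no k≁′i = mk⇔ (λ { (inj₁ k-between) → inj₁ (cyclicBetween-otherBlock nc′ i~′j (sym m~′k) k≁′i k-between)
                       ; (inj₂ i≡k) → contradiction (cong π′ (toℕ-injective i≡k)) (λ i~′k → k≁′i (sym i~′k)) })
                    (λ { (inj₁ m-between) → inj₁ (cyclicBetween-otherBlock nc′ i~′j m~′k m≁′i m-between)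
                       ; (inj₂ m≡j) → contradiction (trans (cong π′ (toℕ-injective m≡j)) (sym i~′j)) m≁′i })
  where
  i~′j : SameBlock π′ i j
  i~′j = π≤π′ i j (sym j~i)
  m≁′i : ¬ SameBlock π′ m i
  m≁′i m~′i = k≁′i (trans (sym m~′k) m~′i)

-- Position (1-based) of the o-th point of the b-th bundle of r consecutive points, both 0-based.
point : ℕ → ℕ → ℕ → ℕ
point r b o = suc (b * r + o)

module _ {r : ℕ} where

  point-<-point : ∀ {b b′ o o′} → o < r → b < b′ → point r b o < point r b′ o′
  point-<-point {b} {b′} {o} {o′} o<r b<b′ = s<s (begin-strict
    b * r + o   <⟨ +-monoʳ-< (b * r) o<r ⟩
    b * r + r   ≡⟨ +-comm (b * r) r ⟩
    suc b * r   ≤⟨ *-monoˡ-≤ r b<b′ ⟩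
    b′ * r      ≤⟨ m≤m+n (b′ * r) o′ ⟩
    b′ * r + o′ ∎)
    where open ≤-Reasoning

  point-<-⇔ : ∀ {b b′ o o′} → o < r → o′ < r → point r b o < point r b′ o′ ⇔ (b < b′ ⊎ b ≡ b′ × o < o′)
  point-<-⇔ {b} {b′} {o} {o′} o<r o′<r = mk⇔ forth back
    where
    forth : point r b o < point r b′ o′ → b < b′ ⊎ b ≡ b′ × o < o′
    forth p<p′ with <-cmp b b′
    ... | tri< b<b′ _ _ = inj₁ b<b′
    ... | tri≈ _ refl _ = inj₂ (refl , +-cancelˡ-< (b * r) o o′ (s<s⁻¹ p<p′))
    ... | tri> _ _ b′<b = contradiction p<p′ (<-asym (point-<-point o′<r b′<b))
    back : b < b′ ⊎ b ≡ b′ × o < o′ → point r b o < point r b′ o′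
    back (inj₁ b<b′)         = point-<-point o<r b<b′
    back (inj₂ (refl , o<o′)) = s<s (+-monoʳ-< (b * r) o<o′)

  point-injective : ∀ {b b′ o o′} → o < r → o′ < r → point r b o ≡ point r b′ o′ → b ≡ b′ × o ≡ o′
  point-injective {b} {b′} {o} {o′} o<r o′<r p≡p′ with <-cmp b b′
  ... | tri< b<b′ _ _ = contradiction p≡p′ (<⇒≢ (point-<-point o<r b<b′))
  ... | tri≈ _ refl _ = refl , +-cancelˡ-≡ (b * r) o o′ (suc-injective p≡p′)
  ... | tri> _ _ b′<b = contradiction (sym p≡p′) (<⇒≢ (point-<-point o′<r b′<b))

  point-≤ : ∀ {b o N} → o < r → b < N → point r b o ≤ N * r
  point-≤ {N = N} o<r b<N = ≤-trans (<⇒≤pred (point-<-point {o′ = 0} o<r b<N)) (≤-reflexive (+-identityʳ (N * r)))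

  point-surjective : ⦃ _ : NonZero r ⦄ → ∀ N {p} → 1 ≤ p → p ≤ N * r → ∃₂ λ b o → b < N × o < r × point r b o ≡ p
  point-surjective N {suc q} _ p≤Nr =
    q / r , q % r , m<n*o⇒m/o<n p≤Nr , m%n<n q r ,
    cong suc (trans (+-comm (q / r * r) (q % r)) (sym (m≡m%n+[m/n]*n q r)))

  cyclicBetween-point : ∀ {a c b oa oc ob} → a ≢ b → oa < r → oc < r → ob < r →
                        CyclicBetween (point r a oa) (point r c oc) (point r b ob) ⇔
                        ((CyclicBetween a c b ⊎ a ≡ c × oa < oc) ⊎ c ≡ b × oc < ob)
  cyclicBetween-point {a} {c} {b} {oa} {oc} {ob} a≢b oa<r oc<r ob<r = mk⇔ forth back
    where
    a<c-⇔ : point r a oa < point r c oc ⇔ (a < c ⊎ a ≡ c × oa < oc)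
    a<c-⇔ = point-<-⇔ oa<r oc<r
    c<b-⇔ : point r c oc < point r b ob ⇔ (c < b ⊎ c ≡ b × oc < ob)
    c<b-⇔ = point-<-⇔ oc<r ob<r

    forth : CyclicBetween (point r a oa) (point r c oc) (point r b ob) →
            (CyclicBetween a c b ⊎ a ≡ c × oa < oc) ⊎ c ≡ b × oc < ob
    forth (inj₁ (pa<pc , pc<pb)) with to a<c-⇔ pa<pc | to c<b-⇔ pc<pb
    ... | inj₂ (a≡c , oa<oc) | _              = inj₁ (inj₂ (a≡c , oa<oc))
    ... | inj₁ _             | inj₂ c≡b×oc<ob = inj₂ c≡b×oc<ob
    ... | inj₁ a<c           | inj₁ c<b       = inj₁ (inj₁ (inj₁ (a<c , c<b)))
    forth (inj₂ (pb≤pa , inj₁ pa<pc)) with to a<c-⇔ pa<pc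
    ... | inj₁ a<c           = inj₁ (inj₁ (inj₂ (≮⇒≥ (λ a<b → <⇒≱ (point-<-point oa<r a<b) pb≤pa) , inj₁ a<c)))
    ... | inj₂ (a≡c , oa<oc) = inj₁ (inj₂ (a≡c , oa<oc))
    forth (inj₂ (pb≤pa , inj₂ pc<pb)) with to c<b-⇔ pc<pb
    ... | inj₁ c<b           = inj₁ (inj₁ (inj₂ (≮⇒≥ (λ a<b → <⇒≱ (point-<-point oa<r a<b) pb≤pa) , inj₂ c<b)))
    ... | inj₂ c≡b×oc<ob     = inj₂ c≡b×oc<ob

    back : (CyclicBetween a c b ⊎ a ≡ c × oa < oc) ⊎ c ≡ b × oc < ob →
           CyclicBetween (point r a oa) (point r c oc) (point r b ob)
    back (inj₁ (inj₁ (inj₁ (a<c , c<b)))) = inj₁ (from a<c-⇔ (inj₁ a<c) , from c<b-⇔ (inj₁ c<b))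
    back (inj₁ (inj₁ (inj₂ (b≤a , c-outside)))) with <-cmp b a | c-outside
    ... | tri≈ _ b≡a _ | _        = contradiction (sym b≡a) a≢b
    ... | tri> _ _ a<b | _        = contradiction b≤a (<⇒≱ a<b)
    ... | tri< b<a _ _ | inj₁ a<c = inj₂ (<⇒≤ (point-<-point ob<r b<a) , inj₁ (from a<c-⇔ (inj₁ a<c)))
    ... | tri< b<a _ _ | inj₂ c<b = inj₂ (<⇒≤ (point-<-point ob<r b<a) , inj₂ (from c<b-⇔ (inj₁ c<b)))
    back (inj₁ (inj₂ (refl , oa<oc))) with <-cmp a b
    ... | tri< a<b _ _ = inj₁ (from a<c-⇔ (inj₂ (refl , oa<oc)) , point-<-point oc<r a<b)
    ... | tri≈ _ a≡b _ = contradiction a≡b a≢b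
    ... | tri> _ _ b<a = inj₂ (<⇒≤ (point-<-point ob<r b<a) , inj₁ (from a<c-⇔ (inj₂ (refl , oa<oc))))
    back (inj₂ (refl , oc<ob)) with <-cmp a b
    ... | tri< a<b _ _ = inj₁ (point-<-point oa<r a<b , from c<b-⇔ (inj₂ (refl , oc<ob)))
    ... | tri≈ _ a≡b _ = contradiction a≡b a≢b
    ... | tri> _ _ b<a = inj₂ (<⇒≤ (point-<-point ob<r b<a) , inj₂ (from c<b-⇔ (inj₂ (refl , oc<ob))))

even≡even⇔ : ∀ {m n} → 2 * m ≡ 2 * n ⇔ m ≡ n
even≡even⇔ {m} {n} = mk⇔ (*-cancelˡ-≡ m n 2) (cong (2 *_))

odd≡odd⇔ : ∀ {m n} → suc (2 * m) ≡ suc (2 * n) ⇔ m ≡ n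
odd≡odd⇔ {m} {n} = mk⇔ (*-cancelˡ-≡ m n 2 ∘ suc-injective) (cong (suc ∘ (2 *_)))

even<even⇔ : ∀ {m n} → 2 * m < 2 * n ⇔ m < n
even<even⇔ {m} {n} = mk⇔ (*-cancelˡ-< 2 m n) (*-monoʳ-< 2)

even<odd⇔ : ∀ {m n} → 2 * m < suc (2 * n) ⇔ m < suc n
even<odd⇔ = mk⇔ (s≤s ∘ *-cancelˡ-≤ 2 ∘ s≤s⁻¹) (s≤s ∘ *-monoʳ-≤ 2 ∘ s≤s⁻¹)

odd<odd⇔ : ∀ {m n} → suc (2 * m) < suc (2 * n) ⇔ suc m < suc n
odd<odd⇔ = mk⇔ (s<s ∘ to even<even⇔ ∘ s<s⁻¹) (s<s ∘ from even<even⇔ ∘ s<s⁻¹)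

odd<even : ∀ {m n} → m < n → suc (2 * m) < 2 * n
odd<even {m} {n} m<n = ≤-trans (≤-reflexive (sym (*-suc 2 m))) (*-monoʳ-≤ 2 m<n)

odd≤even⇔ : ∀ {m n} → suc (2 * m) ≤ 2 * n ⇔ m < n
odd≤even⇔ = mk⇔ (to even<even⇔) (<⇒≤ ∘ odd<even)

cyclicBetween-even-even-odd : ∀ {i k t} → CyclicBetween (2 * i) (2 * k) (suc (2 * t)) ⇔ CyclicBetween i k (suc t)
cyclicBetween-even-even-odd = cyclicBetween-cong even<even⇔ even<odd⇔ odd≤even⇔

cyclicBetween-even-odd-odd : ∀ {i u t} →
                             CyclicBetween (2 * i) (suc (2 * u)) (suc (2 * t)) ⇔ CyclicBetween i (suc u) (suc t)
cyclicBetween-even-odd-odd = cyclicBetween-cong even<odd⇔ odd<odd⇔ odd≤even⇔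

-- j ↦ j − 1 on the cycle 0, 1, …, n − 1: the paper's (j − 1)′ with 0′ = n′, in 0-based labels.
cyclicPred : ℕ → ℕ → ℕ
cyclicPred n zero    = pred n
cyclicPred n (suc j) = j

cyclicPred<n : ∀ {n j} → j < n → cyclicPred n j < n
cyclicPred<n {suc n} {zero} _ = ≤-refl
cyclicPred<n {j = suc j} j<n = <-trans (n<1+n j) j<n

cyclicPred-injective : ∀ {n m j} → m < n → j < n → cyclicPred n m ≡ cyclicPred n j → m ≡ j
cyclicPred-injective {_}     {zero}  {zero}  _   _   _  = refl
cyclicPred-injective {_}     {suc m} {suc j} _   _   eq = cong suc eq
cyclicPred-injective {suc n} {zero}  {suc j} _   j<n eq = contradiction (sym eq) (<⇒≢ (s<s⁻¹ j<n))
cyclicPred-injective {suc n} {suc m} {zero}  m<n _   eq = contradiction eq (<⇒≢ (s<s⁻¹ m<n))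

cyclicPred-surjective : ∀ {n t} → t < n → ∃ λ j → j < n × cyclicPred n j ≡ t
cyclicPred-surjective t<n with m≤n⇒m<n∨m≡n t<n
... | inj₁ 1+t<n = _ , 1+t<n , refl
... | inj₂ refl  = zero , z<s , refl

-- Identifying n with 0 does not change cyclic betweenness of points of 0, …, n.
cyclicBetween-suc-cyclicPredʳ : ∀ {n i k j} → i < n → k < n →
                               CyclicBetween i k (suc (cyclicPred n j)) ⇔ CyclicBetween i k j
cyclicBetween-suc-cyclicPredʳ {_}     {j = suc j} _   _   = ⇔.refl
cyclicBetween-suc-cyclicPredʳ {suc n} {i} {k} {zero} i<n k<n = mk⇔ forth back
  where
  forth : CyclicBetween i k (suc n) → CyclicBetween i k zero
  forth (inj₁ (i<k , _)) = inj₂ (z≤n , inj₁ i<k)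
  forth (inj₂ (n≤i , _)) = contradiction n≤i (<⇒≱ i<n)
  back : CyclicBetween i k zero → CyclicBetween i k (suc n)
  back (inj₂ (_ , inj₁ i<k)) = inj₁ (i<k , k<n)

cyclicBetween-suc-cyclicPred : ∀ {n i m j} → i < n → m < n → j < n →
                                CyclicBetween i (suc (cyclicPred n m)) (suc (cyclicPred n j)) ⇔ CyclicBetween i m j
cyclicBetween-suc-cyclicPred {m = suc m} i<n m<n _ = cyclicBetween-suc-cyclicPredʳ i<n m<n
cyclicBetween-suc-cyclicPred {suc n} {i} {zero} {zero} i<n _ _ = mk⇔ forth back
  where
  forth : CyclicBetween i (suc n) (suc n) → CyclicBetween i zero zero
  forth (inj₁ (_ , n<n)) = contradiction n<n (<-irrefl refl)
  forth (inj₂ (n≤i , _)) = contradiction n≤i (<⇒≱ i<n)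
  back : CyclicBetween i zero zero → CyclicBetween i (suc n) (suc n)
  back (inj₂ (_ , inj₁ ()))
  back (inj₂ (_ , inj₂ ()))
cyclicBetween-suc-cyclicPred {suc n} {i} {zero} {suc j} i<n _ j<n = mk⇔ forth back
  where
  forth : CyclicBetween i (suc n) (suc j) → CyclicBetween i zero (suc j)
  forth (inj₁ (_ , n<j))   = contradiction n<j (<-asym j<n)
  forth (inj₂ (j<i , _))   = inj₂ (j<i , inj₂ z<s)
  back : CyclicBetween i zero (suc j) → CyclicBetween i (suc n) (suc j)
  back (inj₂ (j<i , _))    = inj₂ (j<i , inj₁ i<n)

psiTarget≡suc∘cyclicPred : ∀ {n} (π : Partition n) i → psiTarget π i ≡ suc (cyclicPred n (toℕ (successor π i)))
psiTarget≡suc∘cyclicPred {suc n} π i with toℕ (successor π i)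
... | zero  = refl
... | suc _ = refl

even⊎odd : ∀ b → ∃ λ h → b ≡ 2 * h ⊎ b ≡ suc (2 * h)
even⊎odd zero = zero , inj₁ refl
even⊎odd (suc b) with even⊎odd b
... | h , inj₁ refl = h , inj₂ refl
... | h , inj₂ refl = suc h , inj₁ (sym (*-suc 2 h))

r∸1+[r∸1+o]≡o : ∀ {r o} → o < r → r ∸ suc (r ∸ suc o) ≡ o
r∸1+[r∸1+o]≡o (s≤s o≤r) = m∸[m∸n]≡n o≤r

module Layout (n r : ℕ) where

  unprimed : ℕ → ℕ → ℕ
  unprimed i s = point r (2 * i) s

  -- The s-th point from the right of the primed bundle (j − 1)′, everything 0-based: the end of
  -- the chord of layer s that starts at a point whose block successor is j.
  primed : ℕ → ℕ → ℕ
  primed j s = point r (suc (2 * cyclicPred n j)) (r ∸ suc s)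

  leftPoint≡unprimed : ∀ i s → leftPoint r (suc i) (suc s) ≡ unprimed i s
  leftPoint≡unprimed i s = trans (cong (λ x → (x ∸ 2) * r + suc s) (*-suc 2 i)) (+-suc (2 * i * r) s)

  rightPoint≡primed : ∀ j {s} → s < r → rightPoint r (suc (cyclicPred n j)) (suc s) ≡ primed j s
  rightPoint≡primed j {s} s<r = begin
    2 * suc t * r ∸ suc s + 1            ≡⟨ cong (λ x → x * r ∸ suc s + 1) (*-suc 2 t) ⟩
    r + suc (2 * t) * r ∸ suc s + 1      ≡⟨ cong (_+ 1) (+-∸-comm (suc (2 * t) * r) s<r) ⟩
    r ∸ suc s + suc (2 * t) * r + 1      ≡⟨ +-comm _ 1 ⟩
    suc (r ∸ suc s + suc (2 * t) * r)    ≡⟨ cong suc (+-comm (r ∸ suc s) _) ⟩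
    point r (suc (2 * t)) (r ∸ suc s)    ∎
    where
    open ≡-Reasoning
    t : ℕ
    t = cyclicPred n j

  r∸1+s<r : ∀ {s} → s < r → r ∸ suc s < r
  r∸1+s<r s<r = ∸-monoʳ-< z<s s<r

  r∸1+s<r∸1+s′⇔ : ∀ {s s′} → s < r → s′ < r → r ∸ suc s′ < r ∸ suc s ⇔ s < s′
  r∸1+s<r∸1+s′⇔ {s} {s′} s<r s′<r =
    mk⇔ (λ lt → ≰⇒> (λ s′≤s → <⇒≱ lt (∸-monoʳ-≤ r (s≤s s′≤s)))) (λ s<s′ → ∸-monoʳ-< (s<s s<s′) s′<r)

  cyclicPred-≡-⇔ : ∀ {m j} → m < n → j < n → cyclicPred n m ≡ cyclicPred n j ⇔ m ≡ j
  cyclicPred-≡-⇔ m<n j<n = mk⇔ (cyclicPred-injective m<n j<n) (cong (cyclicPred n))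

  cyclicBetween-unprimed : ∀ {i k j s s′} → i < n → k < n → s < r → s′ < r →
                           CyclicBetween (unprimed i s) (unprimed k s′) (primed j s) ⇔
                           (CyclicBetween i k j ⊎ i ≡ k × s < s′)
  cyclicBetween-unprimed {i} {k} {j} {s} {s′} i<n k<n s<r s′<r = begin
    CyclicBetween (unprimed i s) (unprimed k s′) (primed j s)
      ≈⟨ cyclicBetween-point (even≢odd i t) s<r s′<r (r∸1+s<r s<r) ⟩
    ((CyclicBetween (2 * i) (2 * k) (suc (2 * t)) ⊎ 2 * i ≡ 2 * k × s < s′) ⊎ 2 * k ≡ suc (2 * t) × s′ < r ∸ suc s)
      ≈⟨ ⊎-dropʳ (λ (eq , _) → even≢odd k t eq) ⟩
    (CyclicBetween (2 * i) (2 * k) (suc (2 * t)) ⊎ 2 * i ≡ 2 * k × s < s′)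
      ≈⟨ cyclicBetween-even-even-odd ⊎-⇔ (even≡even⇔ ×-⇔ ⇔.refl) ⟩
    (CyclicBetween i k (suc t) ⊎ i ≡ k × s < s′)
      ≈⟨ cyclicBetween-suc-cyclicPredʳ i<n k<n ⊎-⇔ ⇔.refl ⟩
    (CyclicBetween i k j ⊎ i ≡ k × s < s′) ∎
    where
    open ⇔-Reasoning
    t : ℕ
    t = cyclicPred n j

  cyclicBetween-primed : ∀ {i m j s s′} → i < n → m < n → j < n → s < r → s′ < r →
                         CyclicBetween (unprimed i s) (primed m s′) (primed j s) ⇔
                         (CyclicBetween i m j ⊎ m ≡ j × s < s′)
  cyclicBetween-primed {i} {m} {j} {s} {s′} i<n m<n j<n s<r s′<r = begin
    CyclicBetween (unprimed i s) (primed m s′) (primed j s)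
      ≈⟨ cyclicBetween-point (even≢odd i t) s<r (r∸1+s<r s′<r) (r∸1+s<r s<r) ⟩
    ((CyclicBetween (2 * i) (suc (2 * u)) (suc (2 * t)) ⊎ 2 * i ≡ suc (2 * u) × s < r ∸ suc s′)
      ⊎ suc (2 * u) ≡ suc (2 * t) × r ∸ suc s′ < r ∸ suc s)
      ≈⟨ ⊎-dropʳ (λ (eq , _) → even≢odd i u eq) ⊎-⇔ ⇔.refl ⟩
    (CyclicBetween (2 * i) (suc (2 * u)) (suc (2 * t)) ⊎ suc (2 * u) ≡ suc (2 * t) × r ∸ suc s′ < r ∸ suc s)
      ≈⟨ cyclicBetween-even-odd-odd ⊎-⇔ (odd≡odd⇔ ×-⇔ r∸1+s<r∸1+s′⇔ s<r s′<r) ⟩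
    (CyclicBetween i (suc u) (suc t) ⊎ u ≡ t × s < s′)
      ≈⟨ cyclicBetween-suc-cyclicPred i<n m<n j<n ⊎-⇔ (cyclicPred-≡-⇔ m<n j<n ×-⇔ ⇔.refl) ⟩
    (CyclicBetween i m j ⊎ m ≡ j × s < s′) ∎
    where
    open ⇔-Reasoning
    u : ℕ
    u = cyclicPred n m
    t : ℕ
    t = cyclicPred n j

  unprimed≢primed : ∀ {i j s s′} → s < r → s′ < r → unprimed i s ≢ primed j s′
  unprimed≢primed {i} {j} s<r s′<r eq = even≢odd i (cyclicPred n j) (proj₁ (point-injective s<r (r∸1+s<r s′<r) eq))

  unprimed-injective : ∀ {i k s s′} → s < r → s′ < r → unprimed i s ≡ unprimed k s′ → i ≡ k × s ≡ s′
  unprimed-injective s<r s′<r eq with 2i≡2k , s≡s′ ← point-injective s<r s′<r eq = to even≡even⇔ 2i≡2k , s≡s′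

  primed-injective : ∀ {m j s s′} → m < n → j < n → s < r → s′ < r → primed m s ≡ primed j s′ → m ≡ j × s ≡ s′
  primed-injective m<n j<n s<r s′<r eq
    with 1+2u≡1+2t , r∸1+s≡r∸1+s′ ← point-injective (r∸1+s<r s<r) (r∸1+s<r s′<r) eq
    = to (cyclicPred-≡-⇔ m<n j<n) (to odd≡odd⇔ 1+2u≡1+2t) , suc-injective (∸-cancelˡ-≡ s<r s′<r r∸1+s≡r∸1+s′)

  2*r*n≡2*n*r : 2 * r * n ≡ 2 * n * r
  2*r*n≡2*n*r = trans (*-assoc 2 r n) (trans (cong (2 *_) (*-comm r n)) (sym (*-assoc 2 n r)))

  unprimed≤2rn : ∀ {i s} → i < n → s < r → unprimed i s ≤ 2 * r * n
  unprimed≤2rn i<n s<r = ≤-trans (point-≤ s<r (from even<even⇔ i<n)) (≤-reflexive (sym 2*r*n≡2*n*r))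

  primed≤2rn : ∀ {j s} → j < n → s < r → primed j s ≤ 2 * r * n
  primed≤2rn j<n s<r = ≤-trans (point-≤ (r∸1+s<r s<r) (odd<even (cyclicPred<n j<n))) (≤-reflexive (sym 2*r*n≡2*n*r))

  unprimed+primed : ∀ i j {s} → s < r → unprimed i s + primed j s ∸ 1 ≡ (i + suc (cyclicPred n j)) * (2 * r)
  unprimed+primed i j {s} s<r = begin
    unprimed i s + primed j s ∸ 1                         ≡⟨⟩
    (2 * i * r + s) + suc (suc (2 * t) * r + (r ∸ suc s)) ≡⟨ regroup (2 * i * r) (suc (2 * t) * r) s (r ∸ suc s) ⟩
    2 * i * r + suc (2 * t) * r + (suc s + (r ∸ suc s))   ≡⟨ cong (2 * i * r + suc (2 * t) * r +_) (m+[n∸m]≡n s<r) ⟩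
    2 * i * r + suc (2 * t) * r + r                       ≡⟨ factor i t r ⟩
    (i + suc t) * (2 * r)                                 ∎
    where
    open ≡-Reasoning
    t : ℕ
    t = cyclicPred n j
    regroup : ∀ a b c d → (a + c) + suc (b + d) ≡ a + b + (suc c + d)
    regroup = solve-∀
    factor : ∀ i t r → 2 * i * r + suc (2 * t) * r + r ≡ (i + suc t) * (2 * r)
    factor = solve-∀

  unprimed⊎primed : ⦃ _ : NonZero r ⦄ → ∀ {p} → 1 ≤ p → p ≤ 2 * r * n →
                    ∃₂ λ i s → i < n × s < r × (p ≡ unprimed i s ⊎ p ≡ primed i s)
  unprimed⊎primed 1≤p p≤2rn with point-surjective (2 * n) 1≤p (≤-trans p≤2rn (≤-reflexive 2*r*n≡2*n*r))
  ... | b , o , b<2n , o<r , refl with even⊎odd b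
  ...   | h , inj₁ refl = h , o , to even<even⇔ b<2n , o<r , inj₁ refl
  ...   | h , inj₂ refl with j , j<n , refl ← cyclicPred-surjective {n} {h} (to odd≤even⇔ (<⇒≤ b<2n)) =
    j , r ∸ suc o , j<n , r∸1+s<r o<r , inj₂ (cong (point r (suc (2 * cyclicPred n j))) (sym (r∸1+[r∸1+o]≡o o<r)))

module _ {A B C : Set} (f : A → B → C) where

  concatMap-singletons≡map-cartesianProduct : ∀ xs ys →
    concatMap (λ x → concatMap (λ y → [ f x y ]) ys) xs ≡ map (uncurry f) (cartesianProduct xs ys)
  concatMap-singletons≡map-cartesianProduct []       ys = refl
  concatMap-singletons≡map-cartesianProduct (x ∷ xs) ys = begin
    concatMap (λ y → [ f x y ]) ys ++ concatMap (λ x → concatMap (λ y → [ f x y ]) ys) xs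
      ≡⟨ cong₂ _++_ (trans (sym (concatMap-map [_] (f x) ys)) (concatMap-pure (map (f x) ys)))
                    (concatMap-singletons≡map-cartesianProduct xs ys) ⟩
    map (f x) ys ++ map (uncurry f) (cartesianProduct xs ys)
      ≡⟨ cong (_++ _) (map-∘ ys) ⟩
    map (uncurry f) (map (x ,_) ys) ++ map (uncurry f) (cartesianProduct xs ys)
      ≡⟨ sym (map-++ (uncurry f) (map (x ,_) ys) _) ⟩
    map (uncurry f) (cartesianProduct (x ∷ xs) ys) ∎
    where open ≡-Reasoning

  length-cartesianProductWith : ∀ xs ys → length (cartesianProductWith f xs ys) ≡ length xs * length ys
  length-cartesianProductWith []       ys = refl
  length-cartesianProductWith (x ∷ xs) ys = trans (length-++ (map (f x) ys))
    (cong₂ _+_ (length-map (f x) ys) (length-cartesianProductWith xs ys))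

allPairs-lookup : ∀ {A : Set} {R : A → A → Set} → Symmetric R → ∀ {xs} → AllPairs R xs →
                  ∀ {k l} → k ≢ l → R (lookup xs k) (lookup xs l)
allPairs-lookup sym-R (_ ∷ _)       {Fin.zero} {Fin.zero}  k≢l = contradiction refl k≢l
allPairs-lookup sym-R (Rx ∷ _)      {Fin.zero} {Fin.suc l} _   = All.lookup Rx (∈-lookup l)
allPairs-lookup sym-R (Rx ∷ _)      {Fin.suc k} {Fin.zero} _   = sym-R (All.lookup Rx (∈-lookup k))
allPairs-lookup sym-R (_ ∷ R-pairs) {Fin.suc k} {Fin.suc l} k≢l =
  allPairs-lookup sym-R R-pairs (k≢l ∘ cong Fin.suc)

disjoint-sym : Symmetric Disjoint
disjoint-sym (a≢c , a≢d , b≢c , b≢d) = ≢-sym a≢c , ≢-sym b≢c , ≢-sym a≢d , ≢-sym b≢d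

module Superposition (n r : ℕ) ⦃ _ : NonZero r ⦄ (πs : Fin r → Partition n)
                     (noncrossing : ∀ s → NonCrossing (πs s))
                     (refines : ∀ s t → s ≤ᶠ t → Refines (πs s) (πs t)) where

  open Layout n r

  arch : Fin r → Fin n → Arch
  arch s i = leftPoint r (suc (toℕ i)) (suc (toℕ s)) , rightPoint r (psiTarget (πs s) i) (suc (toℕ s))

  next : Fin r → Fin n → ℕ
  next s i = toℕ (successor (πs s) i)

  arch≡ : ∀ s i → arch s i ≡ (unprimed (toℕ i) (toℕ s) , primed (next s i) (toℕ s))
  arch≡ s i = cong₂ _,_ (leftPoint≡unprimed (toℕ i) (toℕ s))
    (trans (cong (λ t → rightPoint r t (suc (toℕ s))) (psiTarget≡suc∘cyclicPred (πs s) i))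
           (rightPoint≡primed (next s i) (toℕ<n s)))

  chordEnds-⇔ : ∀ s i s′ k →
                (CyclicBetween (toℕ i) (toℕ k) (next s i) ⊎ toℕ i ≡ toℕ k × toℕ s < toℕ s′) ⇔
                (CyclicBetween (toℕ i) (next s′ k) (next s i) ⊎ next s′ k ≡ next s i × toℕ s < toℕ s′)
  chordEnds-⇔ s i s′ k with <-≤-connex (toℕ s) (toℕ s′)
  ... | inj₁ s<s′ = begin
    (CyclicBetween (toℕ i) (toℕ k) (next s i) ⊎ toℕ i ≡ toℕ k × toℕ s < toℕ s′)
      ≈⟨ ⊎-×-absorbʳ s<s′ ⟩
    (CyclicBetween (toℕ i) (toℕ k) (next s i) ⊎ toℕ i ≡ toℕ k)
      ≈⟨ refinement-successor-⇔ (noncrossing s′) (refines s s′ (<⇒≤ s<s′))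
           (successor-isSuccessor (πs s) i) (successor-isSuccessor (πs s′) k) ⟩
    (CyclicBetween (toℕ i) (next s′ k) (next s i) ⊎ next s′ k ≡ next s i)
      ≈⟨ ⇔.sym (⊎-×-absorbʳ s<s′) ⟩
    (CyclicBetween (toℕ i) (next s′ k) (next s i) ⊎ next s′ k ≡ next s i × toℕ s < toℕ s′) ∎
    where open ⇔-Reasoning
  ... | inj₂ s′≤s = begin
    (CyclicBetween (toℕ i) (toℕ k) (next s i) ⊎ toℕ i ≡ toℕ k × toℕ s < toℕ s′)
      ≈⟨ ⊎-dropʳ (λ (_ , s<s′) → <⇒≱ s<s′ s′≤s) ⟩
    CyclicBetween (toℕ i) (toℕ k) (next s i)
      ≈⟨ successor-sameBlock-⇔ (noncrossing s) (successor-isSuccessor (πs s) i)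
           (refines s′ s s′≤s _ _ (proj₁ (successor-isSuccessor (πs s′) k))) ⟩
    CyclicBetween (toℕ i) (next s′ k) (next s i)
      ≈⟨ ⇔.sym (⊎-dropʳ (λ (_ , s<s′) → <⇒≱ s<s′ s′≤s)) ⟩
    (CyclicBetween (toℕ i) (next s′ k) (next s i) ⊎ next s′ k ≡ next s i × toℕ s < toℕ s′) ∎
    where open ⇔-Reasoning

  arches-noncrossing : ∀ s i s′ k → ¬ Crossing (arch s i) (arch s′ k)
  arches-noncrossing s i s′ k = subst₂ (λ x y → ¬ Crossing x y) (sym (arch≡ s i)) (sym (arch≡ s′ k)) $
    sameSide⇒¬Crossing (unprimed≢primed {toℕ i} {next s i} (toℕ<n s) (toℕ<n s)) (begin
      CyclicBetween (unprimed (toℕ i) (toℕ s)) (unprimed (toℕ k) (toℕ s′)) (primed (next s i) (toℕ s))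
        ≈⟨ cyclicBetween-unprimed (toℕ<n i) (toℕ<n k) (toℕ<n s) (toℕ<n s′) ⟩
      _ ≈⟨ chordEnds-⇔ s i s′ k ⟩
      _ ≈⟨ ⇔.sym (cyclicBetween-primed (toℕ<n i) (toℕ<n (successor (πs s′) k)) (toℕ<n (successor (πs s) i))
                                       (toℕ<n s) (toℕ<n s′)) ⟩
      CyclicBetween (unprimed (toℕ i) (toℕ s)) (primed (next s′ k) (toℕ s′)) (primed (next s i) (toℕ s)) ∎)
    where open ⇔-Reasoning

  arches-disjoint : ∀ {p q : Fin r × Fin n} → p ≢ q → Disjoint (uncurry arch p) (uncurry arch q)
  arches-disjoint {s , i} {s′ , k} p≢q = subst₂ Disjoint (sym (arch≡ s i)) (sym (arch≡ s′ k))
    ( (λ eq → let i≡k , s≡s′ = unprimed-injective (toℕ<n s) (toℕ<n s′) eq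
              in p≢q (cong₂ _,_ (toℕ-injective s≡s′) (toℕ-injective i≡k)))
    , unprimed≢primed {toℕ i} {next s′ k} (toℕ<n s) (toℕ<n s′)
    , (λ eq → unprimed≢primed {toℕ k} {next s i} (toℕ<n s′) (toℕ<n s) (sym eq))
    , (λ eq → let next≡ , s≡s′ = primed-injective (toℕ<n (successor (πs s) i)) (toℕ<n (successor (πs s′) k))
                                                    (toℕ<n s) (toℕ<n s′) eq
              in sameNext (toℕ-injective s≡s′) (toℕ-injective next≡)))
    where
    sameNext : s ≡ s′ → successor (πs s) i ≡ successor (πs s′) k → ⊥
    sameNext refl eq = p≢q (cong (s ,_) (successor-injective (πs s) eq))

  InRange : Arch → Set
  InRange (a , b) = 1 ≤ a × a ≤ 2 * r * n × 1 ≤ b × b ≤ 2 * r * n × a ≢ b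

  arch-inRange : ∀ s i → InRange (arch s i)
  arch-inRange s i = subst InRange (sym (arch≡ s i))
    ( s≤s z≤n , unprimed≤2rn (toℕ<n i) (toℕ<n s)
    , s≤s z≤n , primed≤2rn (toℕ<n (successor (πs s) i)) (toℕ<n s)
    , unprimed≢primed {toℕ i} {next s i} (toℕ<n s) (toℕ<n s))

  SumCondition : Arch → Set
  SumCondition (a , b) = 2 * r ∣ a + b ∸ 1

  arch-sumCondition : ∀ s i → SumCondition (arch s i)
  arch-sumCondition s i = subst SumCondition (sym (arch≡ s i))
    (divides (toℕ i + suc (cyclicPred n (next s i))) (unprimed+primed (toℕ i) (next s i) (toℕ<n s)))

  arch-covers : ∀ {p} → 1 ≤ p → p ≤ 2 * r * n → ∃₂ λ s i → OnArch p (arch s i)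
  arch-covers 1≤p p≤2rn with unprimed⊎primed 1≤p p≤2rn
  ... | i , s , i<n , s<r , inj₁ refl = fromℕ< s<r , fromℕ< i<n , inj₁ (sym (begin
    proj₁ (arch (fromℕ< s<r) (fromℕ< i<n))
      ≡⟨ cong proj₁ (arch≡ (fromℕ< s<r) (fromℕ< i<n)) ⟩
    unprimed (toℕ (fromℕ< i<n)) (toℕ (fromℕ< s<r))
      ≡⟨ cong₂ unprimed (toℕ-fromℕ< i<n) (toℕ-fromℕ< s<r) ⟩
    unprimed i s ∎))
    where open ≡-Reasoning
  ... | j , s , j<n , s<r , inj₂ refl
    with i , i↦j ← injective⇒surjective (successor-injective (πs (fromℕ< s<r))) (fromℕ< j<n) =
    fromℕ< s<r , i , inj₂ (sym (begin
    proj₂ (arch (fromℕ< s<r) i)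
      ≡⟨ cong proj₂ (arch≡ (fromℕ< s<r) i) ⟩
    primed (toℕ (successor (πs (fromℕ< s<r)) i)) (toℕ (fromℕ< s<r))
      ≡⟨ cong₂ primed (trans (cong toℕ i↦j) (toℕ-fromℕ< j<n)) (toℕ-fromℕ< s<r) ⟩
    primed j s ∎))
    where open ≡-Reasoning

  arches : List Arch
  arches = map (uncurry arch) (cartesianProduct (allFin r) (allFin n))

  superposition≡arches : superposition r πs ≡ arches
  superposition≡arches = concatMap-singletons≡map-cartesianProduct arch (allFin r) (allFin n)

  ∈-arches⁻ : ∀ {P : Arch → Set} → (∀ s i → P (arch s i)) → ∀ {a} → a ∈ arches → P a
  ∈-arches⁻ P-arch a∈ with (s , i) , _ , refl ← ∈-map⁻ (uncurry arch) a∈ = P-arch s i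

  arch∈arches : ∀ s i → arch s i ∈ arches
  arch∈arches s i = ∈-map⁺ (uncurry arch) (∈-cartesianProduct⁺ (∈-allFin s) (∈-allFin i))

  length-arches : length arches ≡ r * n
  length-arches = begin
    length arches                                   ≡⟨ length-map (uncurry arch) (cartesianProduct (allFin r) _) ⟩
    length (cartesianProduct (allFin r) (allFin n)) ≡⟨ length-cartesianProductWith _,_ (allFin r) (allFin n) ⟩
    length (allFin r) * length (allFin n)           ≡⟨ cong₂ _*_ (length-tabulate {n = r} id) (length-tabulate id) ⟩
    r * n                                           ∎
    where open ≡-Reasoning

  arches-inC : InC n r arches
  arches-inC =
    ( ( (λ k → ∈-arches⁻ {InRange} arch-inRange (∈-lookup k))
      , (λ k l → allPairs-lookup disjoint-sym (AllPairs.map⁺ {R = Disjoint} (AllPairs.map arches-disjoint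
                   (unique-cartesianProduct⁺ (allFin⁺ r) (allFin⁺ n)))))
      , (λ p 1≤p p≤2rn → let s , i , onArch = arch-covers 1≤p p≤2rn in
                           Any.map (λ { refl → onArch }) (arch∈arches s i)) )
    , (λ k l → ∈-arches⁻ {λ a → ∀ {b} → b ∈ arches → ¬ Crossing a b}
                 (λ s i → ∈-arches⁻ {λ b → ¬ Crossing (arch s i) b} (arches-noncrossing s i))
                 (∈-lookup k) (∈-lookup l))
    , (λ k → ∈-arches⁻ {SumCondition} arch-sumCondition (∈-lookup k)) )

mainTheorem5 : (n r : ℕ) → 1 ≤ n → 1 ≤ r →
    (πs : Fin r → Partition n) →
    ((s : Fin r) → NonCrossing (πs s)) →
    ((s t : Fin r) → s ≤ᶠ t → Refines (πs s) (πs t)) →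
    InC n r (superposition r πs) × length (superposition r πs) ≡ r * n
mainTheorem5 n r _ 0<r πs noncrossing refines =
  subst (λ A → InC n r A × length A ≡ r * n) (sym superposition≡arches) (arches-inC , length-arches)
  where
  instance
    r≢0 : NonZero r
    r≢0 = >-nonZero 0<r
  open Superposition n r πs noncrossing refines
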